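{- Let $H$ be a finite Heyting algebra. Then every member $c\colon H\to A$ of the variety $\mathcal{V}(H)$ of étale $H$-algebras validates the identity $\bigvee_{h\in H}(x\Leftrightarrow c_h)=1$, i.e. for every $a\in A$ one has $\bigvee_{h\in H}\big(a\Leftrightarrow c(h)\big)=1_A$.
   Context: For elements $a,b$ of a Heyting algebra, $a\Leftrightarrow b$ denotes $(a\Rightarrow b)\wedge(b\Rightarrow a)$. For a Heyting algebra $H$, an $H$-algebra is a Heyting algebra $A$ together with a Heyting algebra homomorphism $c\colon H\to A$; equivalently, an algebra in the signature of Heyting algebras expanded by a constant $c_h$ for each $h\in H$, satisfying the Heyting algebra identities together with the variable-free identities $w(c_{h_1},\dots,c_{h_n})=c_{w(h_1,\dots,h_n)}$ for each basic $n$-ary Heyting operation $w$ (so $c_h$ is interpreted as $c(h)$). The variety $\mathcal{V}(H)$ of étale $H$-algebras is the subvariety of $H$-algebras generated by the identity map $\mathrm{id}_H\colon H\to H$, i.e. $\mathcal{V}(H)=\mathrm{HSP}(\mathrm{id}_H)$. -}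

module Defs where

open import Level using (Level; _⊔_; suc)
open import Data.Nat using (ℕ)
open import Data.Fin using (Fin)
open import Data.Product using (Σ; ∃; _×_; _,_; proj₁)
open import Relation.Binary.Lattice.Bundles using (HeytingAlgebra)

private variable
  c ℓ₁ ℓ₂ a ℓa₁ ℓa₂ i s : Level

_⇔_ : (A : HeytingAlgebra a ℓa₁ ℓa₂) → HeytingAlgebra.Carrier A →
      HeytingAlgebra.Carrier A → HeytingAlgebra.Carrier A
(A ⇔ x) y = (x ⇨ y) ∧ (y ⇨ x)
  where open HeytingAlgebra A

⋁ : (A : HeytingAlgebra a ℓa₁ ℓa₂) → {n : ℕ} →
    (Fin n → HeytingAlgebra.Carrier A) → HeytingAlgebra.Carrier A
⋁ A {ℕ.zero} f = HeytingAlgebra.⊥ A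
⋁ A {ℕ.suc n} f = HeytingAlgebra._∨_ A (f Fin.zero) (⋁ A (λ k → f (Fin.suc k)))

record Finite (H : HeytingAlgebra c ℓ₁ ℓ₂) : Set (c ⊔ ℓ₁) where
  open HeytingAlgebra H
  field
    size      : ℕ
    enum      : Fin size → Carrier
    surjective : ∀ h → ∃ λ k → enum k ≈ h

record IsHeytingHom (H : HeytingAlgebra c ℓ₁ ℓ₂) (A : HeytingAlgebra a ℓa₁ ℓa₂)
       (f : HeytingAlgebra.Carrier H → HeytingAlgebra.Carrier A)
       : Set (c ⊔ ℓ₁ ⊔ ℓa₁) where
  private
    module H = HeytingAlgebra H
    module A = HeytingAlgebra A
  field
    cong  : ∀ {x y} → x H.≈ y → f x A.≈ f y
    ∧-hom : ∀ x y → f (x H.∧ y) A.≈ (f x A.∧ f y)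
    ∨-hom : ∀ x y → f (x H.∨ y) A.≈ (f x A.∨ f y)
    ⇨-hom : ∀ x y → f (x H.⇨ y) A.≈ (f x A.⇨ f y)
    ⊤-hom : f H.⊤ A.≈ A.⊤
    ⊥-hom : f H.⊥ A.≈ A.⊥

record HAlgebra (H : HeytingAlgebra c ℓ₁ ℓ₂) (a ℓa₁ ℓa₂ : Level)
       : Set (suc (a ⊔ ℓa₁ ⊔ ℓa₂) ⊔ c ⊔ ℓ₁) where
  field
    alg   : HeytingAlgebra a ℓa₁ ℓa₂
    const : HeytingAlgebra.Carrier H → HeytingAlgebra.Carrier alg
    const-hom : IsHeytingHom H alg const

module Pow (H : HeytingAlgebra c ℓ₁ ℓ₂) (I : Set i) where
  private module H = HeytingAlgebra H
  _≈ᴵ_ : (I → H.Carrier) → (I → H.Carrier) → Set (i ⊔ ℓ₁)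
  x ≈ᴵ y = ∀ j → x j H.≈ y j
  _∧ᴵ_ _∨ᴵ_ _⇨ᴵ_ : (I → H.Carrier) → (I → H.Carrier) → (I → H.Carrier)
  x ∧ᴵ y = λ j → x j H.∧ y j
  x ∨ᴵ y = λ j → x j H.∨ y j
  x ⇨ᴵ y = λ j → x j H.⇨ y j
  cᴵ : H.Carrier → (I → H.Carrier)
  cᴵ h = λ _ → h

-- Membership in 𝒱(H) = HSP(id_H), unfolded as: the H-algebra A is a
-- homomorphic image (H) of a subalgebra (S) of a power H^I (P) of id_H.
--   * the power id_H^I has carrier I → H with pointwise operations and
--     pointwise equality, and constants c_h = (λ _ → h);
--   * a subalgebra is a subset S of I → H closed under ∧, ∨, ⇨, ⊤, ⊥
--     and containing all constants c_h;
--   * the image is a surjective H-algebra homomorphism from S onto A.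
record InHSP (H : HeytingAlgebra c ℓ₁ ℓ₂) (i s : Level)
       (𝒜 : HAlgebra H a ℓa₁ ℓa₂)
       : Set (suc (i ⊔ s) ⊔ c ⊔ ℓ₁ ⊔ a ⊔ ℓa₁) where
  private
    module H = HeytingAlgebra H
    module A = HeytingAlgebra (HAlgebra.alg 𝒜)
  field
    I     : Set i
  open Pow H I
  field
    S     : (I → H.Carrier) → Set s
    S-∧   : ∀ {x y} → S x → S y → S (x ∧ᴵ y)
    S-∨   : ∀ {x y} → S x → S y → S (x ∨ᴵ y)
    S-⇨   : ∀ {x y} → S x → S y → S (x ⇨ᴵ y)
    S-⊤   : S (cᴵ H.⊤)
    S-⊥   : S (cᴵ H.⊥)
    S-c   : ∀ h → S (cᴵ h)
    f     : Σ (I → H.Carrier) S → A.Carrier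
    f-cong : ∀ {x y} → proj₁ x ≈ᴵ proj₁ y → f x A.≈ f y
    f-∧   : ∀ {x y} (p : S x) (q : S y) → f (x ∧ᴵ y , S-∧ p q) A.≈ (f (x , p) A.∧ f (y , q))
    f-∨   : ∀ {x y} (p : S x) (q : S y) → f (x ∨ᴵ y , S-∨ p q) A.≈ (f (x , p) A.∨ f (y , q))
    f-⇨   : ∀ {x y} (p : S x) (q : S y) → f (x ⇨ᴵ y , S-⇨ p q) A.≈ (f (x , p) A.⇨ f (y , q))
    f-⊤   : f (cᴵ H.⊤ , S-⊤) A.≈ A.⊤
    f-⊥   : f (cᴵ H.⊥ , S-⊥) A.≈ A.⊥
    f-c   : ∀ h → f (cᴵ h , S-c h) A.≈ HAlgebra.const 𝒜 h
    f-surj : ∀ y → ∃ λ x → f x A.≈ y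

-- In id_H the identity holds because every a ∈ H is some enumerated h, and
-- a ⇔ a = ⊤.  The left-hand side is a finite Heyting term in x and the
-- constants, so the identity holds pointwise in every power H^I, is inherited
-- by subalgebras, and is transported along surjective homomorphisms.
{-# OPTIONS --safe #-}
module Submission where

open import Level using (Level)
open import Data.Nat using (zero; suc)
open import Data.Fin using (Fin; zero; suc)
open import Data.Product using (_,_)
open import Relation.Binary.Lattice.Bundles using (HeytingAlgebra)
import Relation.Binary.Lattice.Properties.HeytingAlgebra as HeytingAlgebraProperties
import Relation.Binary.Lattice.Properties.JoinSemilattice as JoinSemilatticeProperties
import Relation.Binary.Lattice.Properties.MeetSemilattice as MeetSemilatticeProperties
import Relation.Binary.Reasoning.Setoid as SetoidReasoning
open import Defs

module ⋁-Properties {c ℓ₁ ℓ₂ : Level} (A : HeytingAlgebra c ℓ₁ ℓ₂) where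
  open HeytingAlgebra A
  open HeytingAlgebraProperties A using (⇨-cong; ⇨-unit)
  open JoinSemilatticeProperties joinSemilattice using (∨-cong)
  open MeetSemilatticeProperties meetSemilattice using (∧-cong; ∧-idempotent)

  ⇔-cong : ∀ {x x′ y y′} → x ≈ x′ → y ≈ y′ → (A ⇔ x) y ≈ (A ⇔ x′) y′
  ⇔-cong x≈x′ y≈y′ = ∧-cong (⇨-cong x≈x′ y≈y′) (⇨-cong y≈y′ x≈x′)

  x≈y⇒x⇔y≈⊤ : ∀ {x y} → x ≈ y → (A ⇔ x) y ≈ ⊤
  x≈y⇒x⇔y≈⊤ {x} {y} x≈y = begin
    (A ⇔ x) y ≈⟨ ⇔-cong Eq.refl (Eq.sym x≈y) ⟩
    (A ⇔ x) x ≈⟨ ∧-idempotent (x ⇨ x) ⟩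
    x ⇨ x     ≈⟨ ⇨-unit ⟩
    ⊤         ∎
    where open SetoidReasoning setoid

  ⋁-cong : ∀ {n} {g g′ : Fin n → Carrier} → (∀ k → g k ≈ g′ k) → ⋁ A g ≈ ⋁ A g′
  ⋁-cong {zero}  g≈g′ = Eq.refl
  ⋁-cong {suc n} g≈g′ = ∨-cong (g≈g′ zero) (⋁-cong (λ k → g≈g′ (suc k)))

  ≤-⋁ : ∀ {n} (g : Fin n → Carrier) k → g k ≤ ⋁ A g
  ≤-⋁ g zero    = x≤x∨y _ _
  ≤-⋁ g (suc k) = trans (≤-⋁ (λ k → g (suc k)) k) (y≤x∨y _ _)

  ⋁-⊤ : ∀ {n} (g : Fin n → Carrier) k → g k ≈ ⊤ → ⋁ A g ≈ ⊤
  ⋁-⊤ g k gk≈⊤ = antisym (maximum _) (trans (reflexive (Eq.sym gk≈⊤)) (≤-⋁ g k))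

module _ {c ℓ₁ ℓ₂ : Level} {H : HeytingAlgebra c ℓ₁ ℓ₂} (fin : Finite H) where
  open HeytingAlgebra H
  open ⋁-Properties H
  open Finite fin

  ⋁-⇔-enum : ∀ x → ⋁ H (λ k → (H ⇔ x) (enum k)) ≈ ⊤
  ⋁-⇔-enum x with surjective x
  ... | k , enumk≈x = ⋁-⊤ _ k (x≈y⇒x⇔y≈⊤ (Eq.sym enumk≈x))

module InHSP-Properties
    {c ℓ₁ ℓ₂ a ℓa₁ ℓa₂ i s : Level}
    {H : HeytingAlgebra c ℓ₁ ℓ₂} {𝒜 : HAlgebra H a ℓa₁ ℓa₂}
    (M : InHSP H i s 𝒜) where
  private
    module H = HeytingAlgebra H
    module A = HeytingAlgebra (HAlgebra.alg 𝒜)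
  open InHSP M
  open Pow H I
  open MeetSemilatticeProperties A.meetSemilattice using (∧-cong)
  open JoinSemilatticeProperties A.joinSemilattice using (∨-cong)
  open HeytingAlgebraProperties (HAlgebra.alg 𝒜) using (⇨-cong)

  _⇔ᴵ_ : (I → H.Carrier) → (I → H.Carrier) → (I → H.Carrier)
  x ⇔ᴵ y = (x ⇨ᴵ y) ∧ᴵ (y ⇨ᴵ x)

  S-⇔ : ∀ {x y} → S x → S y → S (x ⇔ᴵ y)
  S-⇔ p q = S-∧ (S-⇨ p q) (S-⇨ q p)

  f-⇔ : ∀ {x y} (p : S x) (q : S y) →
        f (x ⇔ᴵ y , S-⇔ p q) A.≈ (HAlgebra.alg 𝒜 ⇔ f (x , p)) (f (y , q))
  f-⇔ p q = A.Eq.trans (f-∧ _ _) (∧-cong (f-⇨ p q) (f-⇨ q p))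

  ⋁ᴵ : ∀ {n} → (Fin n → I → H.Carrier) → I → H.Carrier
  ⋁ᴵ g j = ⋁ H (λ k → g k j)

  S-⋁ : ∀ {n} {g : Fin n → I → H.Carrier} → (∀ k → S (g k)) → S (⋁ᴵ g)
  S-⋁ {zero}  p = S-⊥
  S-⋁ {suc n} p = S-∨ (p zero) (S-⋁ (λ k → p (suc k)))

  f-⋁ : ∀ {n} {g : Fin n → I → H.Carrier} (p : ∀ k → S (g k)) →
        f (⋁ᴵ g , S-⋁ p) A.≈ ⋁ (HAlgebra.alg 𝒜) (λ k → f (g k , p k))
  f-⋁ {zero}  p = f-⊥
  f-⋁ {suc n} p = A.Eq.trans (f-∨ _ _) (∨-cong A.Eq.refl (f-⋁ (λ k → p (suc k))))

proposition1 : ∀ {c ℓ₁ ℓ₂ a ℓa₁ ℓa₂ i s : Level}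
    (H : HeytingAlgebra c ℓ₁ ℓ₂) (fin : Finite H)
    (𝒜 : HAlgebra H a ℓa₁ ℓa₂) → InHSP H i s 𝒜 →
    ∀ (x : HeytingAlgebra.Carrier (HAlgebra.alg 𝒜)) →
    HeytingAlgebra._≈_ (HAlgebra.alg 𝒜)
      (⋁ (HAlgebra.alg 𝒜)
         (λ k → (HAlgebra.alg 𝒜 ⇔ x) (HAlgebra.const 𝒜 (Finite.enum fin k))))
      (HeytingAlgebra.⊤ (HAlgebra.alg 𝒜))
proposition1 H fin 𝒜 M x with InHSP.f-surj M x
... | (σ , σ∈S) , fσ≈x = begin
  ⋁ A (λ k → (A ⇔ x) (const (enum k)))
    ≈⟨ ⋁-cong (λ k → ⇔-cong fσ≈x (f-c (enum k))) ⟨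
  ⋁ A (λ k → (A ⇔ f (σ , σ∈S)) (f (cᴵ (enum k) , S-c (enum k))))
    ≈⟨ ⋁-cong (λ k → f-⇔ σ∈S (S-c (enum k))) ⟨
  ⋁ A (λ k → f (σ ⇔ᴵ cᴵ (enum k) , S-⇔ σ∈S (S-c (enum k))))
    ≈⟨ f-⋁ (λ k → S-⇔ σ∈S (S-c (enum k))) ⟨
  f (⋁ᴵ (λ k → σ ⇔ᴵ cᴵ (enum k)) , S-⋁ (λ k → S-⇔ σ∈S (S-c (enum k))))
    ≈⟨ f-cong (λ j → ⋁-⇔-enum fin (σ j)) ⟩
  f (cᴵ (HeytingAlgebra.⊤ H) , S-⊤)
    ≈⟨ f-⊤ ⟩
  HeytingAlgebra.⊤ A ∎
  where
    open HAlgebra 𝒜 renaming (alg to A)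
    open Finite fin
    open InHSP M
    open Pow H I
    open InHSP-Properties M
    open ⋁-Properties A
    open SetoidReasoning (HeytingAlgebra.setoid A)
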